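{- For a nonnegative integer $n$, let $r_{\mathrm{opt}}(n)$ denote the number of optimal $\{0,1,-1\}$-representations of $n$. Then $r_{\mathrm{opt}}$ is $2$-quasimultiplicative; specifically, for all nonnegative integers $a,b,k$ with $b<2^k$, $$r_{\mathrm{opt}}(2^{k+3}a+b)=r_{\mathrm{opt}}(a)\,r_{\mathrm{opt}}(b).$$
   Context: A $\{0,1,-1\}$-representation of a nonnegative integer $n$ is a finite digit sequence $(\varepsilon_0,\varepsilon_1,\dots,\varepsilon_L)$ with $\varepsilon_i\in\{0,1,-1\}$ and $n=\sum_{i=0}^L\varepsilon_i2^i$, where representations differing only by leading zeros (zeros at the most significant end) are identified. Its Hamming weight is the number of nonzero digits. A representation of $n$ is optimal if its Hamming weight is minimal among all $\{0,1,-1\}$-representations of $n$. A function $f$ is $2$-quasimultiplicative if there is $r\ge0$ with $f(2^{k+r}a+b)=f(a)f(b)$ whenever $0\le b<2^k$. -}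

module Defs where

open import Data.Nat as ℕ using (ℕ)
open import Data.Integer as ℤ using (ℤ; +_; _+_; _*_; -_)
open import Data.List using (List; []; _∷_; length)
open import Data.List.Membership.Propositional using (_∈_)
open import Data.List.Relation.Unary.Unique.Propositional using (Unique)
open import Data.Product using (Σ; _×_)
open import Relation.Binary.PropositionalEquality using (_≡_)
open import Relation.Nullary using (¬_)
open import Data.Unit using (⊤)
open import Function.Bundles using (_⇔_)

data Digit : Set where
  d0 d1 dm1 : Digit

digitVal : Digit → ℤ
digitVal d0  = + 0
digitVal d1  = + 1
digitVal dm1 = - (+ 1)

-- a representation is a digit list, least significant digit first:
-- (ε₀ ∷ ε₁ ∷ … ∷ ε_L ∷ [])
value : List Digit → ℤ
value []       = + 0
value (e ∷ es) = digitVal e + + 2 * value es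

weight : List Digit → ℕ
weight []        = 0
weight (d0 ∷ es) = weight es
weight (d1 ∷ es) = ℕ.suc (weight es)
weight (dm1 ∷ es) = ℕ.suc (weight es)

-- canonical representative of the class modulo leading zeros:
-- the most significant (last) digit is nonzero (or the list is empty)
NoLeadingZero : List Digit → Set
NoLeadingZero []           = ⊤
NoLeadingZero (e ∷ [])     = ¬ (e ≡ d0)
NoLeadingZero (e ∷ f ∷ es) = NoLeadingZero (f ∷ es)

IsRep : ℕ → List Digit → Set
IsRep n ds = NoLeadingZero ds × value ds ≡ + n

IsOptRep : ℕ → List Digit → Set
IsOptRep n ds = IsRep n ds × (∀ es → IsRep n es → weight ds ℕ.≤ weight es)

HasCount : (List Digit → Set) → ℕ → Set
HasCount P m =
  Σ (List (List Digit)) λ xs → length xs ≡ m × Unique xs × (∀ ds → (ds ∈ xs ⇔ P ds))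

ROpt : ℕ → ℕ → Set
ROpt n m = HasCount (IsOptRep n) m

module Submission where

-- Write N = 2^(k+3) a + b. Cutting a representation of N below its digit k+3 leaves a low part
-- of value b and a high part of value a, with one exception forced by b < 2^k: the low k digits
-- represent b - 2^k, digits k, k+1, k+2 are all -1 (value -7 = 1 - 8) and the high part
-- represents a + 1. Replacing that block by 1, 0, 0 and decrementing the high part then gives a
-- representation of N lighter by at least one, so the exception never occurs in an optimal
-- representation. Hence optimal representations of N are exactly an optimal representation of
-- a placed above one of b, the latter padded to k+3 digits (optimal representations of b are
-- that short by the same argument applied to 2^(k+3)·0 + b), and the count is multiplicative.

open import Defs

open import Data.Nat using (ℕ; zero; suc; _+_; _*_; _^_; _<_; _≤_; z≤n; s≤s)
import Data.Nat.Properties as ℕₚ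
import Data.Nat.Tactic.RingSolver as ℕ-Solver
open import Data.Integer as ℤ using (ℤ; +_; -[1+_]; ∣_∣)
import Data.Integer.Properties as ℤₚ
open import Data.Integer.Tactic.RingSolver using (solve-∀)
open import Data.List using (List; []; _∷_; _++_; length; drop; foldr; map; cartesianProduct)
open import Data.List.Properties
  using (drop-[]; drop-drop; drop-all; length-drop; length-++; length-map; ++-identityʳ; map-∘; map-id-local)
open import Data.List.Membership.Propositional using (_∈_)
open import Data.List.Membership.Propositional.Properties
  using (∈-map⁺; ∈-map⁻; ∈-cartesianProduct⁺; ∈-cartesianProduct⁻)
open import Data.List.Relation.Unary.All as All using (All)
open import Data.List.Relation.Unary.Unique.Propositional using (Unique)
import Data.List.Relation.Unary.Unique.Propositional.Properties as Unique
open import Data.Product using (_×_; _,_; ∃; ∃₂; proj₁; proj₂; uncurry)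
open import Data.Sum as Sum using (_⊎_; inj₁; inj₂; [_,_]′)
open import Data.Unit using (tt)
open import Data.Empty using (⊥-elim)
open import Function using (id)
open import Function.Bundles using (_⇔_; mk⇔; Equivalence)
open import Relation.Nullary using (¬_; contradiction)
open import Relation.Binary.PropositionalEquality

infixr 5 _∷ₙ_

_∷ₙ_ : Digit → List Digit → List Digit
d0 ∷ₙ [] = []
e  ∷ₙ es = e ∷ es

normalise : List Digit → List Digit
normalise = foldr _∷ₙ_ []

∷ₙ-∷ : ∀ e y ys → e ∷ₙ y ∷ ys ≡ e ∷ y ∷ ys
∷ₙ-∷ d0  _ _ = refl
∷ₙ-∷ d1  _ _ = refl
∷ₙ-∷ dm1 _ _ = refl

value-∷ₙ : ∀ e es → value (e ∷ₙ es) ≡ value (e ∷ es)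
value-∷ₙ d0  []      = refl
value-∷ₙ d0  (_ ∷ _) = refl
value-∷ₙ d1  _       = refl
value-∷ₙ dm1 _       = refl

weight-∷ₙ : ∀ e es → weight (e ∷ₙ es) ≡ weight (e ∷ es)
weight-∷ₙ d0  []      = refl
weight-∷ₙ d0  (_ ∷ _) = refl
weight-∷ₙ d1  _       = refl
weight-∷ₙ dm1 _       = refl

noLeadingZero-∷ₙ : ∀ e es → NoLeadingZero es → NoLeadingZero (e ∷ₙ es)
noLeadingZero-∷ₙ d0  []      _ = tt
noLeadingZero-∷ₙ d1  []      _ = λ ()
noLeadingZero-∷ₙ dm1 []      _ = λ ()
noLeadingZero-∷ₙ d0  (_ ∷ _) p = p
noLeadingZero-∷ₙ d1  (_ ∷ _) p = p
noLeadingZero-∷ₙ dm1 (_ ∷ _) p = p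

value-normalise : ∀ es → value (normalise es) ≡ value es
value-normalise []       = refl
value-normalise (e ∷ es) =
  trans (value-∷ₙ e (normalise es)) (cong (λ v → digitVal e ℤ.+ + 2 ℤ.* v) (value-normalise es))

weight-∷-cong : ∀ e {xs ys} → weight xs ≡ weight ys → weight (e ∷ xs) ≡ weight (e ∷ ys)
weight-∷-cong d0  p = p
weight-∷-cong d1  p = cong suc p
weight-∷-cong dm1 p = cong suc p

weight-normalise : ∀ es → weight (normalise es) ≡ weight es
weight-normalise []       = refl
weight-normalise (e ∷ es) = trans (weight-∷ₙ e (normalise es)) (weight-∷-cong e (weight-normalise es))

noLeadingZero-normalise : ∀ es → NoLeadingZero (normalise es)
noLeadingZero-normalise []       = tt
noLeadingZero-normalise (e ∷ es) = noLeadingZero-∷ₙ e (normalise es) (noLeadingZero-normalise es)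

normalise-noLeadingZero : ∀ es → NoLeadingZero es → normalise es ≡ es
normalise-noLeadingZero []           _ = refl
normalise-noLeadingZero (d0 ∷ [])    p = ⊥-elim (p refl)
normalise-noLeadingZero (d1 ∷ [])    _ = refl
normalise-noLeadingZero (dm1 ∷ [])   _ = refl
normalise-noLeadingZero (e ∷ y ∷ ys) p =
  trans (cong (e ∷ₙ_) (normalise-noLeadingZero (y ∷ ys) p)) (∷ₙ-∷ e y ys)

noLeadingZero-tail : ∀ e es → NoLeadingZero (e ∷ es) → NoLeadingZero es
noLeadingZero-tail _ []      _ = tt
noLeadingZero-tail _ (_ ∷ _) p = p

noLeadingZero-drop : ∀ n es → NoLeadingZero es → NoLeadingZero (drop n es)
noLeadingZero-drop zero    es       p = p
noLeadingZero-drop (suc n) []       _ = tt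
noLeadingZero-drop (suc n) (e ∷ es) p = noLeadingZero-drop n es (noLeadingZero-tail e es p)

noLeadingZero-weight≡0 : ∀ es → NoLeadingZero es → weight es ≡ 0 → es ≡ []
noLeadingZero-weight≡0 []            _ _ = refl
noLeadingZero-weight≡0 (d0 ∷ [])     p _ = ⊥-elim (p refl)
noLeadingZero-weight≡0 (d0 ∷ y ∷ ys) p w with () ← noLeadingZero-weight≡0 (y ∷ ys) p w

padTake : ℕ → List Digit → List Digit
padTake zero    _        = []
padTake (suc n) []       = d0 ∷ padTake n []
padTake (suc n) (e ∷ es) = e ∷ padTake n es

length-padTake : ∀ n es → length (padTake n es) ≡ n
length-padTake zero    _        = refl
length-padTake (suc n) []       = cong suc (length-padTake n [])
length-padTake (suc n) (_ ∷ es) = cong suc (length-padTake n es)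

padTake-++ : ∀ {n} xs ys → length xs ≡ n → padTake n (xs ++ ys) ≡ xs
padTake-++ []       _  refl = refl
padTake-++ (x ∷ xs) ys refl = cong (x ∷_) (padTake-++ xs ys refl)

drop-++ : ∀ {A : Set} {n} (xs ys : List A) → length xs ≡ n → drop n (xs ++ ys) ≡ ys
drop-++ []       _  refl = refl
drop-++ (_ ∷ xs) ys refl = drop-++ xs ys refl

padTake-∷ₙ : ∀ n e es → padTake (suc n) (e ∷ₙ es) ≡ e ∷ padTake n es
padTake-∷ₙ n d0  []      = refl
padTake-∷ₙ n d0  (_ ∷ _) = refl
padTake-∷ₙ n d1  _       = refl
padTake-∷ₙ n dm1 _       = refl

padTake-normalise : ∀ {n} es → length es ≡ n → padTake n (normalise es) ≡ es
padTake-normalise []       refl = refl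
padTake-normalise (e ∷ es) refl =
  trans (padTake-∷ₙ (length es) e (normalise es)) (cong (e ∷_) (padTake-normalise es refl))

normalise-padTake-++-drop : ∀ n es → normalise (padTake n es ++ drop n es) ≡ normalise es
normalise-padTake-++-drop zero    es       = refl
normalise-padTake-++-drop (suc n) []       =
  cong (d0 ∷ₙ_) (trans (cong (λ zs → normalise (padTake n [] ++ zs)) (sym (drop-[] n)))
                       (normalise-padTake-++-drop n []))
normalise-padTake-++-drop (suc n) (e ∷ es) = cong (e ∷ₙ_) (normalise-padTake-++-drop n es)

padTake-+ : ∀ m n es → padTake (m + n) es ≡ padTake m es ++ padTake n (drop m es)
padTake-+ zero    n es       = refl
padTake-+ (suc m) n []       =
  cong (d0 ∷_) (trans (padTake-+ m n []) (cong (λ zs → padTake m [] ++ padTake n zs) (drop-[] m)))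
padTake-+ (suc m) n (e ∷ es) = cong (e ∷_) (padTake-+ m n es)

weight-++ : ∀ xs ys → weight (xs ++ ys) ≡ weight xs + weight ys
weight-++ []         ys = refl
weight-++ (d0 ∷ xs)  ys = weight-++ xs ys
weight-++ (d1 ∷ xs)  ys = cong suc (weight-++ xs ys)
weight-++ (dm1 ∷ xs) ys = cong suc (weight-++ xs ys)

weight-padTake-drop : ∀ n es → weight (padTake n es) + weight (drop n es) ≡ weight es
weight-padTake-drop zero    es         = refl
weight-padTake-drop (suc n) []         =
  trans (cong (λ zs → weight (padTake n []) + weight zs) (sym (drop-[] n))) (weight-padTake-drop n [])
weight-padTake-drop (suc n) (d0 ∷ es)  = weight-padTake-drop n es
weight-padTake-drop (suc n) (d1 ∷ es)  = cong suc (weight-padTake-drop n es)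
weight-padTake-drop (suc n) (dm1 ∷ es) = cong suc (weight-padTake-drop n es)

drop-∷ₙ : ∀ n e es → drop (suc n) (e ∷ₙ es) ≡ drop n es
drop-∷ₙ n d0  []      = sym (drop-[] n)
drop-∷ₙ n d0  (_ ∷ _) = refl
drop-∷ₙ n d1  _       = refl
drop-∷ₙ n dm1 _       = refl

drop-normalise : ∀ n es → drop n (normalise es) ≡ normalise (drop n es)
drop-normalise zero    es       = refl
drop-normalise (suc n) []       = refl
drop-normalise (suc n) (e ∷ es) = trans (drop-∷ₙ n e (normalise es)) (drop-normalise n es)

normalise-padTake-normalise : ∀ n es → normalise (padTake n (normalise es)) ≡ normalise (padTake n es)
normalise-padTake-normalise zero    es       = refl
normalise-padTake-normalise (suc n) []       = refl
normalise-padTake-normalise (suc n) (e ∷ es) =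
  trans (cong normalise (padTake-∷ₙ n e (normalise es))) (cong (e ∷ₙ_) (normalise-padTake-normalise n es))

normalise-padTake : ∀ n es → length es ≤ n → normalise (padTake n es) ≡ normalise es
normalise-padTake n es len≤n = begin
  normalise (padTake n es)                ≡⟨ cong normalise (++-identityʳ (padTake n es)) ⟨
  normalise (padTake n es ++ [])          ≡⟨ cong (λ zs → normalise (padTake n es ++ zs)) (drop-all n es len≤n) ⟨
  normalise (padTake n es ++ drop n es)   ≡⟨ normalise-padTake-++-drop n es ⟩
  normalise es                            ∎
  where open ≡-Reasoning

length≤-drop≡[] : ∀ {A : Set} n (xs : List A) → drop n xs ≡ [] → length xs ≤ n
length≤-drop≡[] n xs drop≡[] = ℕₚ.m∸n≡0⇒m≤n (trans (sym (length-drop n xs)) (cong length drop≡[]))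

value-∷-shift : ∀ e xs n z →
  value (e ∷ xs) ℤ.+ + 2 ^ suc n ℤ.* z ≡ digitVal e ℤ.+ + 2 ℤ.* (value xs ℤ.+ + 2 ^ n ℤ.* z)
value-∷-shift e xs n z =
  trans (cong (λ p → value (e ∷ xs) ℤ.+ p ℤ.* z) (ℤₚ.pos-* 2 (2 ^ n)))
        (reassociate (digitVal e) (value xs) (+ 2 ^ n) z)
  where
  reassociate : ∀ d x y z → (d ℤ.+ + 2 ℤ.* x) ℤ.+ (+ 2 ℤ.* y) ℤ.* z ≡ d ℤ.+ + 2 ℤ.* (x ℤ.+ y ℤ.* z)
  reassociate = solve-∀

value-++ : ∀ xs ys → value (xs ++ ys) ≡ value xs ℤ.+ + 2 ^ length xs ℤ.* value ys
value-++ []       ys = sym (trans (ℤₚ.+-identityˡ _) (ℤₚ.*-identityˡ _))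
value-++ (x ∷ xs) ys = trans (cong (λ v → digitVal x ℤ.+ + 2 ℤ.* v) (value-++ xs ys))
                             (sym (value-∷-shift x xs (length xs) (value ys)))

value-padTake-drop : ∀ n es → value (padTake n es) ℤ.+ + 2 ^ n ℤ.* value (drop n es) ≡ value es
value-padTake-drop zero    es       = trans (ℤₚ.+-identityˡ _) (ℤₚ.*-identityˡ _)
value-padTake-drop (suc n) []       =
  trans (value-∷-shift d0 (padTake n []) n (value (drop (suc n) [])))
        (cong (λ v → + 0 ℤ.+ + 2 ℤ.* v)
              (trans (cong (λ zs → value (padTake n []) ℤ.+ + 2 ^ n ℤ.* value zs) (sym (drop-[] n)))
                     (value-padTake-drop n [])))
value-padTake-drop (suc n) (e ∷ es) =
  trans (value-∷-shift e (padTake n es) n (value (drop n es)))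
        (cong (λ v → digitVal e ℤ.+ + 2 ℤ.* v) (value-padTake-drop n es))

∣value∣<2^length : ∀ es → ∣ value es ∣ < 2 ^ length es
∣value∣<2^length []       = s≤s z≤n
∣value∣<2^length (e ∷ es) = begin-strict
  ∣ digitVal e ℤ.+ + 2 ℤ.* value es ∣      ≤⟨ ℤₚ.∣i+j∣≤∣i∣+∣j∣ (digitVal e) (+ 2 ℤ.* value es) ⟩
  (∣ digitVal e ∣) + (∣ + 2 ℤ.* value es ∣) ≡⟨ cong (_+_ ∣ digitVal e ∣) (ℤₚ.abs-* (+ 2) (value es)) ⟩
  (∣ digitVal e ∣) + 2 * (∣ value es ∣)     ≤⟨ ℕₚ.+-monoˡ-≤ (2 * ∣ value es ∣) (∣digitVal∣≤1 e) ⟩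
  1 + 2 * (∣ value es ∣)                    <⟨ ℕₚ.n<1+n _ ⟩
  2 + 2 * (∣ value es ∣)                    ≡⟨ ℕₚ.*-suc 2 ∣ value es ∣ ⟨
  2 * suc (∣ value es ∣)                    ≤⟨ ℕₚ.*-monoʳ-≤ 2 (∣value∣<2^length es) ⟩
  2 * 2 ^ length es                         ∎
  where
  open ℕₚ.≤-Reasoning
  ∣digitVal∣≤1 : ∀ e → ∣ digitVal e ∣ ≤ 1
  ∣digitVal∣≤1 d0  = z≤n
  ∣digitVal∣≤1 d1  = s≤s z≤n
  ∣digitVal∣≤1 dm1 = s≤s z≤n

decrement : List Digit → List Digit
decrement []         = dm1 ∷ []
decrement (d0 ∷ es)  = dm1 ∷ es
decrement (d1 ∷ es)  = d0 ∷ es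
decrement (dm1 ∷ es) = d0 ∷ decrement es

value-decrement : ∀ es → value (decrement es) ≡ value es ℤ.- + 1
value-decrement []         = refl
value-decrement (d0 ∷ es)  = lemma (value es)
  where
  lemma : ∀ v → ℤ.- + 1 ℤ.+ + 2 ℤ.* v ≡ (+ 0 ℤ.+ + 2 ℤ.* v) ℤ.- + 1
  lemma = solve-∀
value-decrement (d1 ∷ es)  = lemma (value es)
  where
  lemma : ∀ v → + 0 ℤ.+ + 2 ℤ.* v ≡ (+ 1 ℤ.+ + 2 ℤ.* v) ℤ.- + 1
  lemma = solve-∀
value-decrement (dm1 ∷ es) =
  trans (cong (λ v → + 0 ℤ.+ + 2 ℤ.* v) (value-decrement es)) (lemma (value es))
  where
  lemma : ∀ v → + 0 ℤ.+ + 2 ℤ.* (v ℤ.- + 1) ≡ (ℤ.- + 1 ℤ.+ + 2 ℤ.* v) ℤ.- + 1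
  lemma = solve-∀

weight-decrement : ∀ es → weight (decrement es) ≤ suc (weight es)
weight-decrement []         = s≤s z≤n
weight-decrement (d0 ∷ es)  = ℕₚ.≤-refl
weight-decrement (d1 ∷ es)  = ℕₚ.m≤n⇒m≤1+n (ℕₚ.n≤1+n _)
weight-decrement (dm1 ∷ es) = ℕₚ.m≤n⇒m≤1+n (weight-decrement es)

-- Carries across a cut

carry-bound : ∀ p {b} l u → ∣ l ∣ < p → b < p → l ℤ.+ + p ℤ.* u ≡ + b → ∣ u ∣ < 2
carry-bound p {b} l u ∣l∣<p b<p eq = ℕₚ.*-cancelˡ-< p ∣ u ∣ 2 (begin-strict
  p * (∣ u ∣)            ≡⟨ ℤₚ.abs-* (+ p) u ⟨
  ∣ + p ℤ.* u ∣          ≡⟨ cong ∣_∣ (trans (sym (cancel l (+ p ℤ.* u))) (cong (ℤ._- l) eq)) ⟩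
  ∣ + b ℤ.- l ∣          ≤⟨ ℤₚ.∣i-j∣≤∣i∣+∣j∣ (+ b) l ⟩
  b + (∣ l ∣)            <⟨ ℕₚ.+-mono-<-≤ b<p (ℕₚ.<⇒≤ ∣l∣<p) ⟩
  p + p                  ≡⟨ trans (ℕₚ.*-suc p 1) (cong (_+_ p) (ℕₚ.*-identityʳ p)) ⟨
  p * 2                  ∎)
  where
  open ℕₚ.≤-Reasoning
  cancel : ∀ l x → (l ℤ.+ x) ℤ.- l ≡ x
  cancel = solve-∀

carry∈01 : ∀ p {b} l u → ∣ l ∣ < p → b < p → l ℤ.+ + p ℤ.* u ≡ + b → u ≡ + 0 ⊎ u ≡ + 1
carry∈01 p l (+ 0)            _    _   _  = inj₁ refl
carry∈01 p l (+ 1)            _    _   _  = inj₂ refl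
carry∈01 p l u@(+ suc (suc _)) ∣l∣<p b<p eq with s≤s (s≤s ()) ← carry-bound p l u ∣l∣<p b<p eq
carry∈01 p l u@(-[1+ suc _ ]) ∣l∣<p b<p eq with s≤s (s≤s ()) ← carry-bound p l u ∣l∣<p b<p eq
carry∈01 p {b} l -[1+ 0 ] ∣l∣<p _ eq = contradiction (subst (p ≤_) (cong ∣_∣ (sym l≡b+p)) (ℕₚ.m≤n+m p b)) (ℕₚ.<⇒≱ ∣l∣<p)
  where
  unshift : ∀ l x → l ≡ (l ℤ.+ x ℤ.* -[1+ 0 ]) ℤ.+ x
  unshift = solve-∀
  l≡b+p : l ≡ + (b + p)
  l≡b+p = trans (unshift l (+ p)) (trans (cong (ℤ._+ + p) eq) (sym (ℤₚ.pos-+ b p)))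

value≡-7 : ∀ x y z → value (x ∷ y ∷ z ∷ []) ≡ -[1+ 6 ] → x ∷ y ∷ z ∷ [] ≡ dm1 ∷ dm1 ∷ dm1 ∷ []
value≡-7 d0  d0  d0  ()
value≡-7 d0  d0  d1  ()
value≡-7 d0  d0  dm1 ()
value≡-7 d0  d1  d0  ()
value≡-7 d0  d1  d1  ()
value≡-7 d0  d1  dm1 ()
value≡-7 d0  dm1 d0  ()
value≡-7 d0  dm1 d1  ()
value≡-7 d0  dm1 dm1 ()
value≡-7 d1  d0  d0  ()
value≡-7 d1  d0  d1  ()
value≡-7 d1  d0  dm1 ()
value≡-7 d1  d1  d0  ()
value≡-7 d1  d1  d1  ()
value≡-7 d1  d1  dm1 ()
value≡-7 d1  dm1 d0  ()
value≡-7 d1  dm1 d1  ()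
value≡-7 d1  dm1 dm1 ()
value≡-7 dm1 d0  d0  ()
value≡-7 dm1 d0  d1  ()
value≡-7 dm1 d0  dm1 ()
value≡-7 dm1 d1  d0  ()
value≡-7 dm1 d1  d1  ()
value≡-7 dm1 d1  dm1 ()
value≡-7 dm1 dm1 d0  ()
value≡-7 dm1 dm1 d1  ()
value≡-7 dm1 dm1 dm1 _ = refl

value-padTake3≡-7 : ∀ es → value (padTake 3 es) ≡ -[1+ 6 ] → padTake 3 es ≡ dm1 ∷ dm1 ∷ dm1 ∷ []
value-padTake3≡-7 []                = value≡-7 d0 d0 d0
value-padTake3≡-7 (x ∷ [])          = value≡-7 x d0 d0
value-padTake3≡-7 (x ∷ y ∷ [])      = value≡-7 x y d0
value-padTake3≡-7 (x ∷ y ∷ z ∷ _)  = value≡-7 x y z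

∣value-padTake∣<2^ : ∀ n es → ∣ value (padTake n es) ∣ < 2 ^ n
∣value-padTake∣<2^ n es = subst (λ m → ∣ value (padTake n es) ∣ < 2 ^ m) (length-padTake n es)
                                (∣value∣<2^length (padTake n es))

value-padTake-++ : ∀ k xs es → value (padTake k es ++ xs) ≡ value (padTake k es) ℤ.+ + 2 ^ k ℤ.* value xs
value-padTake-++ k xs es = trans (value-++ (padTake k es) xs)
  (cong (λ n → value (padTake k es) ℤ.+ + 2 ^ n ℤ.* value xs) (length-padTake k es))

pos-2^[k+3]*a+b : ∀ k a b → + (2 ^ (k + 3) * a + b) ≡ + 2 ^ k ℤ.* (+ 8 ℤ.* + a) ℤ.+ + b
pos-2^[k+3]*a+b k a b = begin
  + (2 ^ (k + 3) * a + b)         ≡⟨ cong (λ p → + (p * a + b)) (ℕₚ.^-distribˡ-+-* 2 k 3) ⟩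
  + (2 ^ k * 8 * a + b)           ≡⟨ ℤₚ.pos-+ (2 ^ k * 8 * a) b ⟩
  + (2 ^ k * 8 * a) ℤ.+ + b       ≡⟨ cong (ℤ._+ + b) (trans (cong +_ (ℕₚ.*-assoc (2 ^ k) 8 a))
                                       (trans (ℤₚ.pos-* (2 ^ k) (8 * a))
                                              (cong (+ 2 ^ k ℤ.*_) (ℤₚ.pos-* 8 a)))) ⟩
  + 2 ^ k ℤ.* (+ 8 ℤ.* + a) ℤ.+ + b ∎
  where open ≡-Reasoning

borrow≡1 : ∀ {c} m → ∣ m ∣ < 8 → c ≤ 1 → m ≡ + c ℤ.- + 8 → c ≡ 1
borrow≡1 {0} _ ∣m∣<8 _ refl = contradiction ∣m∣<8 (ℕₚ.<-irrefl refl)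
borrow≡1 {1} _ _     _ _    = refl
borrow≡1 {suc (suc _)} _ _ (s≤s ()) _

window-split : ∀ {a c} R → c ≤ 1 → value R ≡ + 8 ℤ.* + a ℤ.+ + c →
    (value (padTake 3 R) ≡ + c × value (drop 3 R) ≡ + a)
  ⊎ (padTake 3 R ≡ dm1 ∷ dm1 ∷ dm1 ∷ [] × c ≡ 1 × value (drop 3 R) ≡ + suc a)
window-split {a} {c} R c≤1 value≡ =
  Sum.map noCarry withCarry
    (carry∈01 8 (value M) (value H ℤ.- + a) (∣value-padTake∣<2^ 3 R) (ℕₚ.≤-<-trans c≤1 (s≤s (s≤s z≤n))) midEq)
  where
  M = padTake 3 R
  H = drop 3 R

  restore : ∀ h a → h ≡ (h ℤ.- a) ℤ.+ a
  restore = solve-∀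

  midEq : value M ℤ.+ + 8 ℤ.* (value H ℤ.- + a) ≡ + c
  midEq = trans (shift (value M) (value H) (+ a)) (trans (cong (ℤ._- + 8 ℤ.* + a) (value-padTake-drop 3 R))
                                                         (trans (cong (ℤ._- + 8 ℤ.* + a) value≡) (cancel (+ 8 ℤ.* + a) (+ c))))
    where
    shift : ∀ m h a → m ℤ.+ + 8 ℤ.* (h ℤ.- a) ≡ (m ℤ.+ + 8 ℤ.* h) ℤ.- + 8 ℤ.* a
    shift = solve-∀
    cancel : ∀ x c → (x ℤ.+ c) ℤ.- x ≡ c
    cancel = solve-∀

  midEqAt : ∀ {d} → value H ℤ.- + a ≡ d → value M ℤ.+ + 8 ℤ.* d ≡ + c
  midEqAt refl = midEq

  noCarry : value H ℤ.- + a ≡ + 0 → value M ≡ + c × value H ≡ + a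
  noCarry d≡0 = trans (sym (ℤₚ.+-identityʳ (value M))) (midEqAt d≡0) ,
                trans (restore (value H) (+ a)) (cong (ℤ._+ + a) d≡0)

  withCarry : value H ℤ.- + a ≡ + 1 → M ≡ dm1 ∷ dm1 ∷ dm1 ∷ [] × c ≡ 1 × value H ≡ + suc a
  withCarry d≡1 = value-padTake3≡-7 R (trans valueM (cong (λ c → + c ℤ.- + 8) c≡1)) ,
                  c≡1 ,
                  trans (restore (value H) (+ a)) (cong (ℤ._+ + a) d≡1)
    where
    unshift : ∀ m → m ≡ (m ℤ.+ + 8 ℤ.* + 1) ℤ.- + 8
    unshift = solve-∀
    valueM : value M ≡ + c ℤ.- + 8
    valueM = trans (unshift (value M)) (cong (ℤ._- + 8) (midEqAt d≡1))
    c≡1 : c ≡ 1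
    c≡1 = borrow≡1 (value M) (∣value-padTake∣<2^ 3 R) c≤1 valueM

SplitsAt : ℕ → ℕ → ℕ → List Digit → Set
SplitsAt k a b E = value (padTake (k + 3) E) ≡ + b × value (drop (k + 3) E) ≡ + a

SplitsWithCarry : ℕ → ℕ → ℕ → List Digit → Set
SplitsWithCarry k a b E =
  padTake (k + 3) E ≡ padTake k E ++ dm1 ∷ dm1 ∷ dm1 ∷ []
  × value (padTake k E ++ d1 ∷ d0 ∷ d0 ∷ []) ≡ + b
  × value (drop (k + 3) E) ≡ + suc a

lowHigh-split : ∀ {k b} a E → b < 2 ^ k → value E ≡ + (2 ^ (k + 3) * a + b) →
  SplitsAt k a b E ⊎ SplitsWithCarry k a b E
lowHigh-split {k} {b} a E b<2^k value≡ =
  [ atCarry 0 z≤n , atCarry 1 (s≤s z≤n) ]′ (carry∈01 (2 ^ k) (value T) u (∣value-padTake∣<2^ k E) b<2^k lowEq)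
  where
  T = padTake k E
  R = drop k E
  u = value R ℤ.- + 8 ℤ.* + a

  lowEq : value T ℤ.+ + 2 ^ k ℤ.* u ≡ + b
  lowEq = begin
    value T ℤ.+ + 2 ^ k ℤ.* u
      ≡⟨ distrib (value T) (+ 2 ^ k) (value R) (+ 8 ℤ.* + a) ⟩
    (value T ℤ.+ + 2 ^ k ℤ.* value R) ℤ.- + 2 ^ k ℤ.* (+ 8 ℤ.* + a)
      ≡⟨ cong (ℤ._- + 2 ^ k ℤ.* (+ 8 ℤ.* + a))
              (trans (value-padTake-drop k E) (trans value≡ (pos-2^[k+3]*a+b k a b))) ⟩
    (+ 2 ^ k ℤ.* (+ 8 ℤ.* + a) ℤ.+ + b) ℤ.- + 2 ^ k ℤ.* (+ 8 ℤ.* + a)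
      ≡⟨ cancel (+ 2 ^ k ℤ.* (+ 8 ℤ.* + a)) (+ b) ⟩
    + b ∎
    where
    open ≡-Reasoning
    distrib : ∀ t p r x → t ℤ.+ p ℤ.* (r ℤ.- x) ≡ (t ℤ.+ p ℤ.* r) ℤ.- p ℤ.* x
    distrib = solve-∀
    cancel : ∀ x b → (x ℤ.+ b) ℤ.- x ≡ b
    cancel = solve-∀

  atCarry : ∀ c → c ≤ 1 → u ≡ + c → SplitsAt k a b E ⊎ SplitsWithCarry k a b E
  atCarry c c≤1 u≡c = Sum.map noCarry withCarry (window-split R c≤1 valueR≡)
    where
    swap : ∀ r x → r ≡ x ℤ.+ (r ℤ.- x)
    swap = solve-∀
    valueR≡ : value R ≡ + 8 ℤ.* + a ℤ.+ + c
    valueR≡ = trans (swap (value R) (+ 8 ℤ.* + a)) (cong (ℤ._+_ (+ 8 ℤ.* + a)) u≡c)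

    lowEqAt : ∀ {d} → c ≡ d → value T ℤ.+ + 2 ^ k ℤ.* + d ≡ + b
    lowEqAt refl = subst (λ v → value T ℤ.+ + 2 ^ k ℤ.* v ≡ + b) u≡c lowEq

    noCarry : value (padTake 3 R) ≡ + c × value (drop 3 R) ≡ + a → SplitsAt k a b E
    noCarry (valueM≡ , valueH≡) = lowValue , trans (cong value (sym (drop-drop k 3 E))) valueH≡
      where
      lowValue : value (padTake (k + 3) E) ≡ + b
      lowValue = begin
        value (padTake (k + 3) E)                   ≡⟨ cong value (padTake-+ k 3 E) ⟩
        value (T ++ padTake 3 R)                    ≡⟨ value-padTake-++ k (padTake 3 R) E ⟩
        value T ℤ.+ + 2 ^ k ℤ.* value (padTake 3 R) ≡⟨ cong (λ m → value T ℤ.+ + 2 ^ k ℤ.* m) valueM≡ ⟩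
        value T ℤ.+ + 2 ^ k ℤ.* + c                 ≡⟨ lowEqAt refl ⟩
        + b                                         ∎
        where open ≡-Reasoning

    withCarry : padTake 3 R ≡ dm1 ∷ dm1 ∷ dm1 ∷ [] × c ≡ 1 × value (drop 3 R) ≡ + suc a → SplitsWithCarry k a b E
    withCarry (M≡ , c≡1 , valueH≡) =
      trans (padTake-+ k 3 E) (cong (T ++_) M≡) ,
      trans (value-padTake-++ k (d1 ∷ d0 ∷ d0 ∷ []) E) (lowEqAt c≡1) ,
      trans (cong value (sym (drop-drop k 3 E))) valueH≡

-- Optimal representations of 2^(k+3) a + b

MinWeight : ℕ → ℕ → Set
MinWeight n w = ∀ es → IsRep n es → w ≤ weight es

isRep-normalise : ∀ {n} es → value es ≡ + n → IsRep n (normalise es)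
isRep-normalise es value≡ = noLeadingZero-normalise es , trans (value-normalise es) value≡

minWeight-value : ∀ {n w} → MinWeight n w → ∀ es → value es ≡ + n → w ≤ weight es
minWeight-value {w = w} min es value≡ =
  subst (w ≤_) (weight-normalise es) (min (normalise es) (isRep-normalise es value≡))

module Concatenation {k b : ℕ} (b<2^k : b < 2 ^ k) where

  K : ℕ
  K = k + 3

  N : ℕ → ℕ
  N a = 2 ^ K * a + b

  IsCut : ℕ → List Digit → List Digit → Set
  IsCut a L H = length L ≡ K × value L ≡ + b × value H ≡ + a

  value-cut : ∀ {a} L H → IsCut a L H → value (L ++ H) ≡ + N a
  value-cut {a} L H (length≡ , valueL≡ , valueH≡) = begin
    value (L ++ H)                            ≡⟨ value-++ L H ⟩
    value L ℤ.+ + 2 ^ length L ℤ.* value H    ≡⟨ cong₂ (λ l n → l ℤ.+ + 2 ^ n ℤ.* value H) valueL≡ length≡ ⟩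
    + b ℤ.+ + 2 ^ K ℤ.* value H               ≡⟨ cong (λ h → + b ℤ.+ + 2 ^ K ℤ.* h) valueH≡ ⟩
    + b ℤ.+ + 2 ^ K ℤ.* + a                   ≡⟨ cong (ℤ._+_ (+ b)) (ℤₚ.pos-* (2 ^ K) a) ⟨
    + b ℤ.+ + (2 ^ K * a)                     ≡⟨ ℤₚ.+-comm (+ b) (+ (2 ^ K * a)) ⟩
    + (2 ^ K * a) ℤ.+ + b                     ≡⟨ ℤₚ.pos-+ (2 ^ K * a) b ⟨
    + N a                                     ∎
    where open ≡-Reasoning

  Cut< : ℕ → List Digit → Set
  Cut< a E = ∃₂ λ L H → IsCut a L H × weight L + weight H < weight E

  carry⇒lighterCut : ∀ a E → SplitsWithCarry k a b E → Cut< a E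
  carry⇒lighterCut a E (padTake≡ , valueL≡ , valueD≡) =
    L , decrement D , (length-L , valueL≡ , trans (value-decrement D) (cong (ℤ._- + 1) valueD≡)) , lighter
    where
    T = padTake k E
    L = T ++ d1 ∷ d0 ∷ d0 ∷ []
    D = drop K E
    length-L : length L ≡ K
    length-L = trans (length-++ T) (cong (_+ 3) (length-padTake k E))
    lighter : weight L + weight (decrement D) < weight E
    lighter = begin-strict
      weight L + weight (decrement D)          ≤⟨ ℕₚ.+-monoʳ-≤ (weight L) (weight-decrement D) ⟩
      weight L + suc (weight D)                ≡⟨ cong (_+ suc (weight D)) (weight-++ T (d1 ∷ d0 ∷ d0 ∷ [])) ⟩
      (weight T + 1) + suc (weight D)          <⟨ ℕₚ.n<1+n _ ⟩
      suc ((weight T + 1) + suc (weight D))    ≡⟨ rearrange (weight T) (weight D) ⟩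
      (weight T + 3) + weight D                ≡⟨ cong (λ t → t + weight D) weight-padTake ⟨
      weight (padTake K E) + weight D          ≡⟨ weight-padTake-drop K E ⟩
      weight E                                 ∎
      where
      open ℕₚ.≤-Reasoning
      rearrange : ∀ t d → suc ((t + 1) + suc d) ≡ (t + 3) + d
      rearrange = ℕ-Solver.solve-∀
      weight-padTake : weight (padTake K E) ≡ weight T + 3
      weight-padTake = trans (cong weight padTake≡) (weight-++ T (dm1 ∷ dm1 ∷ dm1 ∷ []))

  cut-or-lighter : ∀ a E → value E ≡ + N a → SplitsAt k a b E ⊎ Cut< a E
  cut-or-lighter a E value≡ = Sum.map₂ (carry⇒lighterCut a E) (lowHigh-split a E b<2^k value≡)

  Cut≤ : ℕ → List Digit → Set
  Cut≤ a E = ∃₂ λ L H → IsCut a L H × weight L + weight H ≤ weight E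

  cut : ∀ a E → value E ≡ + N a → Cut≤ a E
  cut a E value≡ = [ splitsAt⇒cut , cut<⇒cut≤ ]′ (cut-or-lighter a E value≡)
    where
    splitsAt⇒cut : SplitsAt k a b E → Cut≤ a E
    splitsAt⇒cut (valueL≡ , valueH≡) =
      padTake K E , drop K E , (length-padTake K E , valueL≡ , valueH≡) , ℕₚ.≤-reflexive (weight-padTake-drop K E)
    cut<⇒cut≤ : Cut< a E → Cut≤ a E
    cut<⇒cut≤ (L , H , isCut , lighter) = L , H , isCut , ℕₚ.<⇒≤ lighter

  minWeight-N : ∀ {a wA wB} → MinWeight a wA → MinWeight b wB → MinWeight (N a) (wB + wA)
  minWeight-N {a} minA minB E (_ , value≡) =
    let L , H , (_ , valueL≡ , valueH≡) , weight≤ = cut a E value≡ in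
    ℕₚ.≤-trans (ℕₚ.+-mono-≤ (minWeight-value minB L valueL≡) (minWeight-value minA H valueH≡)) weight≤

  value≡N0 : ∀ E → value E ≡ + b → value E ≡ + N 0
  value≡N0 E value≡ = trans value≡ (cong (λ m → + (m + b)) (sym (ℕₚ.*-zeroʳ (2 ^ K))))

  shortRep : ∀ E → value E ≡ + b → ∃ λ L → length L ≡ K × value L ≡ + b × weight L ≤ weight E
  shortRep E value≡ =
    let L , H , (length≡ , valueL≡ , _) , weight≤ = cut 0 E (value≡N0 E value≡) in
    L , length≡ , valueL≡ , ℕₚ.≤-trans (ℕₚ.m≤m+n (weight L) (weight H)) weight≤

  optimal-length≤ : ∀ B → IsOptRep b B → length B ≤ K
  optimal-length≤ B ((noLeadingZero , value≡) , minimal) =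
    [ splitsAt⇒length≤ , (λ cut< → contradiction cut< notLighter) ]′ (cut-or-lighter 0 B (value≡N0 B value≡))
    where
    notLighter : ¬ Cut< 0 B
    notLighter (L , H , (_ , valueL≡ , _) , lighter) = ℕₚ.<⇒≱ lighter
      (ℕₚ.≤-trans (minWeight-value minimal L valueL≡) (ℕₚ.m≤m+n (weight L) (weight H)))

    splitsAt⇒length≤ : SplitsAt k 0 b B → length B ≤ K
    splitsAt⇒length≤ (valueL≡ , _) = length≤-drop≡[] K B
      (noLeadingZero-weight≡0 (drop K B) (noLeadingZero-drop K B noLeadingZero) weight-drop≡0)
      where
      weight-drop≡0 : weight (drop K B) ≡ 0
      weight-drop≡0 = ℕₚ.n≤0⇒n≡0 (ℕₚ.+-cancelˡ-≤ (weight (padTake K B)) _ 0 (begin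
        weight (padTake K B) + weight (drop K B) ≡⟨ weight-padTake-drop K B ⟩
        weight B                                 ≤⟨ minWeight-value minimal (padTake K B) valueL≡ ⟩
        weight (padTake K B)                     ≡⟨ ℕₚ.+-identityʳ _ ⟨
        weight (padTake K B) + 0                 ∎))
        where open ℕₚ.≤-Reasoning

  join : List Digit → List Digit → List Digit
  join A B = normalise (padTake K B ++ A)

  high low : List Digit → List Digit
  high R = drop K R
  low R = normalise (padTake K R)

  unjoin : List Digit → List Digit × List Digit
  unjoin R = high R , low R

  low-optimal : ∀ {B} → IsOptRep b B → low B ≡ B
  low-optimal {B} optB =
    trans (normalise-padTake K B (optimal-length≤ B optB)) (normalise-noLeadingZero B (proj₁ (proj₁ optB)))

  unjoin-join : ∀ {a A B} → IsOptRep a A → IsOptRep b B → unjoin (join A B) ≡ (A , B)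
  unjoin-join {A = A} {B} optA optB = cong₂ _,_
    (trans (drop-normalise K (P ++ A))
      (trans (cong normalise (drop-++ P A (length-padTake K B)))
        (normalise-noLeadingZero A (proj₁ (proj₁ optA)))))
    (trans (normalise-padTake-normalise K (P ++ A))
      (trans (cong normalise (padTake-++ P A (length-padTake K B)))
        (low-optimal optB)))
    where P = padTake K B

  join-optimal : ∀ {a A B} → IsOptRep a A → IsOptRep b B → IsOptRep (N a) (join A B)
  join-optimal {a} {A} {B} optA optB =
    isRep-normalise (P ++ A) (value-cut P A (length-padTake K B , valueP≡ , proj₂ (proj₁ optA))) ,
    λ E isRep → subst (_≤ weight E) (sym weight-join) (minWeight-N (proj₂ optA) (proj₂ optB) E isRep)
    where
    P = padTake K B
    P≈B : normalise P ≡ B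
    P≈B = low-optimal optB
    valueP≡ : value P ≡ + b
    valueP≡ = trans (sym (value-normalise P)) (trans (cong value P≈B) (proj₂ (proj₁ optB)))
    weight-join : weight (join A B) ≡ weight B + weight A
    weight-join = trans (weight-normalise (P ++ A))
      (trans (weight-++ P A) (cong (_+ weight A) (trans (sym (weight-normalise P)) (cong weight P≈B))))

  optimal-exchange : ∀ {a} R → IsOptRep (N a) R → ∀ L H → IsCut a L H → weight R ≤ weight L + weight H
  optimal-exchange R (_ , minimal) L H isCut =
    subst (weight R ≤_) (weight-++ L H) (minWeight-value minimal (L ++ H) (value-cut L H isCut))

  optimal⇒splitsAt : ∀ {a} R → IsOptRep (N a) R → SplitsAt k a b R
  optimal⇒splitsAt {a} R optR@((_ , value≡) , _) =
    [ id , (λ (L , H , isCut , lighter) → contradiction (optimal-exchange R optR L H isCut) (ℕₚ.<⇒≱ lighter)) ]′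
    (cut-or-lighter a R value≡)

  optimal-split : ∀ {a} R → IsOptRep (N a) R → IsOptRep a (high R) × IsOptRep b (low R) × join (high R) (low R) ≡ R
  optimal-split {a} R optR@((noLeadingZero , _) , _) =
    ((noLeadingZero-drop K R noLeadingZero , valueH≡) , highMinimal) ,
    (isRep-normalise ℓ valueℓ≡ , lowMinimal) ,
    joinR
    where
    ℓ = padTake K R
    H = drop K R
    valueℓ≡ = proj₁ (optimal⇒splitsAt R optR)
    valueH≡ = proj₂ (optimal⇒splitsAt R optR)
    weightR : weight ℓ + weight H ≡ weight R
    weightR = weight-padTake-drop K R

    highMinimal : MinWeight a (weight H)
    highMinimal E (_ , valueE≡) = ℕₚ.+-cancelˡ-≤ (weight ℓ) _ _
      (subst (_≤ weight ℓ + weight E) (sym weightR)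
        (optimal-exchange R optR ℓ E (length-padTake K R , valueℓ≡ , valueE≡)))

    lowMinimal : MinWeight b (weight (normalise ℓ))
    lowMinimal E (_ , valueE≡) =
      let L , length≡ , valueL≡ , weightL≤ = shortRep E valueE≡ in
      subst (_≤ weight E) (sym (weight-normalise ℓ)) (ℕₚ.≤-trans (ℕₚ.+-cancelʳ-≤ (weight H) _ _
        (subst (_≤ weight L + weight H) (sym weightR)
          (optimal-exchange R optR L H (length≡ , valueL≡ , valueH≡)))) weightL≤)

    joinR : join H (normalise ℓ) ≡ R
    joinR = begin
      normalise (padTake K (normalise ℓ) ++ H) ≡⟨ cong (λ zs → normalise (zs ++ H)) (padTake-normalise ℓ (length-padTake K R)) ⟩
      normalise (ℓ ++ H)                       ≡⟨ normalise-padTake-++-drop K R ⟩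
      normalise R                              ≡⟨ normalise-noLeadingZero R noLeadingZero ⟩
      R                                        ∎
      where open ≡-Reasoning

  optimal⇔join : ∀ {a} R → IsOptRep (N a) R ⇔ (∃₂ λ A B → IsOptRep a A × IsOptRep b B × join A B ≡ R)
  optimal⇔join R = mk⇔
    (λ optR → let optA , optB , joinR = optimal-split R optR in _ , _ , optA , optB , joinR)
    (λ { (A , B , optA , optB , refl) → join-optimal optA optB })

-- Counting

length-cartesianProduct : ∀ {A B : Set} (xs : List A) (ys : List B) →
  length (cartesianProduct xs ys) ≡ length xs * length ys
length-cartesianProduct []       ys = refl
length-cartesianProduct (x ∷ xs) ys =
  trans (length-++ (map (x ,_) ys)) (cong₂ _+_ (length-map (x ,_) ys) (length-cartesianProduct xs ys))

hasCount-image : ∀ {P Q R : List Digit → Set} {m n}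
  (f : List Digit → List Digit → List Digit) (f⁻¹ : List Digit → List Digit × List Digit) →
  (∀ {x y} → P x → Q y → f⁻¹ (f x y) ≡ (x , y)) →
  (∀ z → R z ⇔ (∃₂ λ x y → P x × Q y × f x y ≡ z)) →
  HasCount P m → HasCount Q n → HasCount R (m * n)
hasCount-image {P} {Q} {R} f f⁻¹ inverse image (xs , length-xs , unique-xs , ∈xs⇔) (ys , length-ys , unique-ys , ∈ys⇔) =
  map (uncurry f) pairs ,
  trans (length-map (uncurry f) pairs) (trans (length-cartesianProduct xs ys) (cong₂ _*_ length-xs length-ys)) ,
  Unique.map⁻ (subst Unique (sym roundtrip) (Unique.cartesianProduct⁺ unique-xs unique-ys)) ,
  λ z → mk⇔ (to z) (from z)
  where
  pairs = cartesianProduct xs ys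

  members : ∀ {p} → p ∈ pairs → P (proj₁ p) × Q (proj₂ p)
  members {x , y} p∈pairs with x∈xs , y∈ys ← ∈-cartesianProduct⁻ xs ys p∈pairs =
    Equivalence.to (∈xs⇔ x) x∈xs , Equivalence.to (∈ys⇔ y) y∈ys

  roundtrip : map f⁻¹ (map (uncurry f) pairs) ≡ pairs
  roundtrip = trans (sym (map-∘ pairs)) (map-id-local (All.tabulate (λ p∈pairs → uncurry inverse (members p∈pairs))))

  to : ∀ z → z ∈ map (uncurry f) pairs → R z
  to z z∈ with (x , y) , p∈pairs , refl ← ∈-map⁻ (uncurry f) z∈ =
    Equivalence.from (image z) (x , y , proj₁ (members p∈pairs) , proj₂ (members p∈pairs) , refl)

  from : ∀ z → R z → z ∈ map (uncurry f) pairs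
  from z Rz with x , y , Px , Qy , refl ← Equivalence.to (image z) Rz =
    ∈-map⁺ (uncurry f) (∈-cartesianProduct⁺ (Equivalence.from (∈xs⇔ x) Px) (Equivalence.from (∈ys⇔ y) Qy))

mainTheorem11 : (a b k : ℕ) → b < 2 ^ k → (m₁ m₂ : ℕ) →
    ROpt a m₁ → ROpt b m₂ → ROpt (2 ^ (k + 3) * a + b) (m₁ * m₂)
mainTheorem11 a b k b<2^k _ _ = hasCount-image join unjoin unjoin-join optimal⇔join
  where open Concatenation {k} {b} b<2^k
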